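{- Let $\Pi_q$ be any projective plane of order $q$ (not necessarily desarguesian), with point set $\mathcal{P}$ and line set $\mathcal{L}$, and let $f:\mathcal{L}\to\mathbb{N}$ be an arbitrary function. Then there exists a set $S\subseteq\mathcal{P}$ such that $|S\cap\ell|\neq f(\ell)$ for every line $\ell\in\mathcal{L}$.
   Context: A projective plane of order $q$ is an incidence structure with $q^2+q+1$ points and $q^2+q+1$ lines such that any two distinct points lie on a unique common line, any two distinct lines meet in a unique point, every line contains $q+1$ points and every point lies on $q+1$ lines. Lines are identified with their point sets. $\mathbb{N}$ denotes the non-negative integers. -}

module Defs where

open import Data.Nat using (ℕ; suc; _+_; _*_)
open import Data.Fin using (Fin)
open import Data.Fin.Subset using (Subset; _∈_; _∩_; ∣_∣)
open import Data.Product using (Σ; _×_; ∃!)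
open import Relation.Binary.PropositionalEquality using (_≡_; _≢_)
open import Data.Vec using (tabulate; lookup)

planeSize : ℕ → ℕ
planeSize q = q * q + q + 1

linesThrough : ∀ {n} → (Fin n → Subset n) → Fin n → Subset n
linesThrough line p = tabulate (λ l → lookup (line l) p)

record ProjectivePlane (q : ℕ) : Set where
  field
    line : Fin (planeSize q) → Subset (planeSize q)
    line-injective : ∀ l m → line l ≡ line m → l ≡ m
    two-points : ∀ p r → p ≢ r →
      ∃! _≡_ (λ l → (p ∈ line l) × (r ∈ line l))
    two-lines : ∀ l m → l ≢ m →
      ∃! _≡_ (λ p → (p ∈ line l) × (p ∈ line m))
    line-size : ∀ l → ∣ line l ∣ ≡ suc q
    point-degree : ∀ p → ∣ linesThrough line p ∣ ≡ suc q

-- Match every point X with a line μ X through it, injectively (hence bijectively).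
-- Then the n affine forms L_X(x) = |x ∩ μ X| - f(μ X) in n Boolean variables have a
-- nonnegative coefficient matrix with positive diagonal, so its permanent is positive.
-- The top finite difference Δ of ∏ L_X over the cube {0,1}ⁿ equals this permanent, so
-- ∏ L_X does not vanish identically on the cube, and a point x where it does not
-- vanish is the required set S.  For the matching, take a line m, a point P off m, a
-- point Q on m and a fixed-point-free permutation σ of m: send P to PQ, Q to m, any
-- other X on m to PX, and any X off m ∪ {P} to the line through X and σ(PX ∩ m).

module Submission where

open import Defs
open import Data.Bool using (Bool; true; false)
open import Data.Fin using (Fin; zero; suc; punchIn; punchOut; _≤_; _<_)
open import Data.Fin.Properties
  using (_≟_; _<?_; any?; ¬∀⟶∃¬; <-cmp; <⇒≢; toℕ-injective; punchOut-injective; injective⇒≤)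
open import Data.Fin.Subset using (Subset; _∈_; _∉_; _⊆_; _∩_; ⁅_⁆; ⊤; ∣_∣; Nonempty)
open import Data.Fin.Subset.Properties
  using (_∈?_; nonempty?; Empty-unique; ∣⊥∣≡0; ∣⊤∣≡n; p⊆q⇒∣p∣≤∣q∣; ∣⁅x⁆∣≡1; x∈⁅x⁆)
open import Data.Integer as ℤ using (ℤ; 0ℤ; 1ℤ; +_; -_; _+_; _-_; _*_; +≤+; +<+)
open import Data.Integer.Properties
  using (pos-*; +-identityˡ; +-identityʳ; +-inverseʳ; *-identityˡ; *-zeroˡ; *-zeroʳ; *-assoc; *-distribʳ-+;
         +-mono-≤; +-mono-<-≤; <-irrefl; ≤-refl; +-*-semiring; *-1-monoid)
open import Data.Integer.Tactic.RingSolver using (solve-∀)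
open import Data.Nat as ℕ using (ℕ; zero; suc; s≤s; z≤n)
import Data.Nat.Properties as ℕ
open import Data.Product using (Σ; ∃-syntax; _×_; _,_; proj₁; proj₂)
open import Data.Vec using (Vec; []; _∷_; lookup; insertAt)
open import Data.Vec.Properties using (insertAt-lookup; insertAt-punchIn; []=⇒lookup)
open import Data.Vec.Functional using (removeAt)
open import Function using (_∘_; id)
open import Function.Definitions using (Injective)
open import Level using (0ℓ)
open import Relation.Binary using (tri<; tri≈; tri>)
open import Relation.Binary.PropositionalEquality
open import Relation.Nullary using (¬_; yes; no; contradiction)
open import Relation.Nullary.Decidable using (_×-dec_; ¬?; decidable-stable)
open import Relation.Unary using (Pred; Decidable)

open import Algebra.Properties.Semiring.Sum +-*-semiring
  using (sum; sum-syntax; sum-cong-≗; sum-remove; sum-replicate-zero; *-distribʳ-sum)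
open import Algebra.Properties.Monoid.Sum *-1-monoid using () renaming (sum to product)

-- Finite differences on the Boolean cube

χ : Bool → ℤ
χ true  = 1ℤ
χ false = 0ℤ

-- Δ k P = ∑ₓ (-1)^(k - |x|) P x is the coefficient of x₁⋯x_k in the multilinear
-- polynomial that agrees with P on the cube.
Δ : ∀ k → (Vec Bool k → ℤ) → ℤ
Δ zero    P = P []
Δ (suc k) P = Δ k (P ∘ (true ∷_)) - Δ k (P ∘ (false ∷_))

Δ-cong : ∀ k {P Q : Vec Bool k → ℤ} → (∀ x → P x ≡ Q x) → Δ k P ≡ Δ k Q
Δ-cong zero    P≗Q = P≗Q []
Δ-cong (suc k) P≗Q = cong₂ _-_ (Δ-cong k (P≗Q ∘ (true ∷_))) (Δ-cong k (P≗Q ∘ (false ∷_)))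

Δ-zero : ∀ k → Δ k (λ _ → 0ℤ) ≡ 0ℤ
Δ-zero zero    = refl
Δ-zero (suc k) = cong₂ _-_ (Δ-zero k) (Δ-zero k)

Δ-+ : ∀ k (P Q : Vec Bool k → ℤ) → Δ k (λ x → P x + Q x) ≡ Δ k P + Δ k Q
Δ-+ zero    P Q = refl
Δ-+ (suc k) P Q =
  trans (cong₂ _-_ (Δ-+ k P₁ Q₁) (Δ-+ k P₀ Q₀)) (interchange (Δ k P₁) (Δ k Q₁) (Δ k P₀) (Δ k Q₀))
  where
  P₁ = P ∘ (true ∷_)
  P₀ = P ∘ (false ∷_)
  Q₁ = Q ∘ (true ∷_)
  Q₀ = Q ∘ (false ∷_)
  interchange : ∀ a b c d → (a + b) - (c + d) ≡ (a - c) + (b - d)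
  interchange = solve-∀

Δ-*ˡ : ∀ k c (P : Vec Bool k → ℤ) → Δ k (λ x → c * P x) ≡ c * Δ k P
Δ-*ˡ zero    c P = refl
Δ-*ˡ (suc k) c P = trans (cong₂ _-_ (Δ-*ˡ k c (P ∘ (true ∷_))) (Δ-*ˡ k c (P ∘ (false ∷_)))) (factor c _ _)
  where
  factor : ∀ c a b → c * a - c * b ≡ c * (a - b)
  factor = solve-∀

Δ-sum : ∀ k {m} (P : Fin m → Vec Bool k → ℤ) → Δ k (λ x → ∑[ j < m ] P j x) ≡ ∑[ j < m ] Δ k (P j)
Δ-sum k {zero}  P = Δ-zero k
Δ-sum k {suc m} P = trans (Δ-+ k (P zero) _) (cong (_+_ (Δ k (P zero))) (Δ-sum k (P ∘ suc)))

Δ-insertAt : ∀ k (j : Fin (suc k)) (P : Vec Bool (suc k) → ℤ) →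
  Δ (suc k) P ≡ Δ k (λ y → P (insertAt y j true)) - Δ k (λ y → P (insertAt y j false))
Δ-insertAt k       zero    P = refl
Δ-insertAt (suc k) (suc j) P =
  trans (cong₂ _-_ (Δ-insertAt k j (P ∘ (true ∷_))) (Δ-insertAt k j (P ∘ (false ∷_))))
        (interchange (Δ[ true , true ]) (Δ[ true , false ]) (Δ[ false , true ]) (Δ[ false , false ]))
  where
  Δ[_,_] : Bool → Bool → ℤ
  Δ[ b₀ , bⱼ ] = Δ k (λ y → P (b₀ ∷ insertAt y j bⱼ))
  interchange : ∀ a b c d → (a - b) - (c - d) ≡ (a - c) - (b - d)
  interchange = solve-∀

Δ-χ* : ∀ k (j : Fin (suc k)) (P : Vec Bool (suc k) → ℤ) →
  Δ (suc k) (λ x → χ (lookup x j) * P x) ≡ Δ k (λ y → P (insertAt y j true))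
Δ-χ* k j P = begin
  Δ (suc k) (λ x → χ (lookup x j) * P x)
    ≡⟨ Δ-insertAt k j (λ x → χ (lookup x j) * P x) ⟩
  Δ k (λ y → χ (lookup (insertAt y j true) j) * P (insertAt y j true))
    - Δ k (λ y → χ (lookup (insertAt y j false) j) * P (insertAt y j false))
    ≡⟨ cong₂ _-_ (Δ-cong k (λ y → cong (λ b → χ b * P (insertAt y j true)) (insertAt-lookup y j true)))
                 (Δ-cong k (λ y → cong (λ b → χ b * P (insertAt y j false)) (insertAt-lookup y j false))) ⟩
  Δ k (λ y → 1ℤ * P (insertAt y j true)) - Δ k (λ _ → 0ℤ)
    ≡⟨ cong₂ _-_ (Δ-cong k (λ y → *-identityˡ _)) (Δ-zero k) ⟩
  Δ k (λ y → P (insertAt y j true)) - 0ℤ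
    ≡⟨ +-identityʳ _ ⟩
  Δ k (λ y → P (insertAt y j true)) ∎
  where open ≡-Reasoning

Δ≢0⇒∃≢0 : ∀ k (P : Vec Bool k → ℤ) → Δ k P ≢ 0ℤ → ∃[ x ] P x ≢ 0ℤ
Δ≢0⇒∃≢0 zero    P Δ≢0 = [] , Δ≢0
Δ≢0⇒∃≢0 (suc k) P Δ≢0 with Δ k (P ∘ (true ∷_)) ℤ.≟ 0ℤ
... | no  Δ₁≢0 = let (x , Px≢0) = Δ≢0⇒∃≢0 k (P ∘ (true ∷_)) Δ₁≢0 in true ∷ x , Px≢0
... | yes Δ₁≡0 = let (x , Px≢0) = Δ≢0⇒∃≢0 k (P ∘ (false ∷_)) (Δ≢0 ∘ cong₂ _-_ Δ₁≡0) in false ∷ x , Px≢0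

-- Affine forms and the permanent

record AffineForm (k : ℕ) : Set where
  constructor affine
  field
    coeff : Fin k → ℤ
    const : ℤ

open AffineForm

⟦_⟧ : ∀ {k} → AffineForm k → Vec Bool k → ℤ
⟦ L ⟧ x = ∑[ j < _ ] (coeff L j * χ (lookup x j)) + const L

restrict : ∀ {k} → AffineForm (suc k) → Fin (suc k) → AffineForm k
restrict L j = affine (removeAt (coeff L) j) (const L + coeff L j)

⟦restrict⟧ : ∀ {k} (L : AffineForm (suc k)) j (y : Vec Bool k) → ⟦ L ⟧ (insertAt y j true) ≡ ⟦ restrict L j ⟧ y
⟦restrict⟧ {k} L j y = begin
  sum t + const L                               ≡⟨ cong (_+ const L) (sum-remove {i = j} t) ⟩
  (t j + sum (removeAt t j)) + const L          ≡⟨ cong₂ (λ u v → (u + v) + const L) tⱼ≡aⱼ removeAt-t≡ ⟩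
  (coeff L j * 1ℤ + rest) + const L             ≡⟨ rearrange (coeff L j) rest (const L) ⟩
  rest + (const L + coeff L j)                  ∎
  where
  open ≡-Reasoning
  t : Fin (suc k) → ℤ
  t i = coeff L i * χ (lookup (insertAt y j true) i)
  rest : ℤ
  rest = ∑[ i < k ] (coeff L (punchIn j i) * χ (lookup y i))
  tⱼ≡aⱼ : t j ≡ coeff L j * 1ℤ
  tⱼ≡aⱼ = cong (λ b → coeff L j * χ b) (insertAt-lookup y j true)
  removeAt-t≡ : sum (removeAt t j) ≡ rest
  removeAt-t≡ = sum-cong-≗ (λ i → cong (λ b → coeff L (punchIn j i) * χ b) (insertAt-punchIn y j true i))
  rearrange : ∀ a s c → (a * 1ℤ + s) + c ≡ s + (c + a)
  rearrange = solve-∀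

⟦⟧*-expand : ∀ {k} (L : AffineForm k) (P : Vec Bool k → ℤ) x →
  ⟦ L ⟧ x * P x ≡ ∑[ j < k ] (coeff L j * (χ (lookup x j) * P x)) + const L * P x
⟦⟧*-expand L P x = begin
  (∑[ j < _ ] (coeff L j * χ (lookup x j)) + const L) * P x
    ≡⟨ *-distribʳ-+ (P x) (∑[ j < _ ] (coeff L j * χ (lookup x j))) (const L) ⟩
  (∑[ j < _ ] (coeff L j * χ (lookup x j))) * P x + const L * P x
    ≡⟨ cong (_+ const L * P x) (*-distribʳ-sum (P x) (λ j → coeff L j * χ (lookup x j))) ⟩
  ∑[ j < _ ] (coeff L j * χ (lookup x j) * P x) + const L * P x
    ≡⟨ cong (_+ const L * P x) (sum-cong-≗ (λ j → *-assoc (coeff L j) (χ (lookup x j)) (P x))) ⟩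
  ∑[ j < _ ] (coeff L j * (χ (lookup x j) * P x)) + const L * P x ∎
  where open ≡-Reasoning

Δ-⟦⟧* : ∀ {k} (L : AffineForm (suc k)) (P : Vec Bool (suc k) → ℤ) →
  Δ (suc k) (λ x → ⟦ L ⟧ x * P x)
    ≡ ∑[ j < suc k ] (coeff L j * Δ k (λ y → P (insertAt y j true))) + const L * Δ (suc k) P
Δ-⟦⟧* {k} L P = begin
  Δ (suc k) (λ x → ⟦ L ⟧ x * P x)
    ≡⟨ Δ-cong (suc k) (⟦⟧*-expand L P) ⟩
  Δ (suc k) (λ x → ∑[ j < suc k ] (coeff L j * (χ (lookup x j) * P x)) + const L * P x)
    ≡⟨ Δ-+ (suc k) (λ x → ∑[ j < suc k ] (coeff L j * (χ (lookup x j) * P x))) (λ x → const L * P x) ⟩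
  Δ (suc k) (λ x → ∑[ j < suc k ] (coeff L j * (χ (lookup x j) * P x))) + Δ (suc k) (λ x → const L * P x)
    ≡⟨ cong₂ _+_ (Δ-sum (suc k) (λ j x → coeff L j * (χ (lookup x j) * P x))) (Δ-*ˡ (suc k) (const L) P) ⟩
  ∑[ j < suc k ] Δ (suc k) (λ x → coeff L j * (χ (lookup x j) * P x)) + const L * Δ (suc k) P
    ≡⟨ cong (_+ const L * Δ (suc k) P) (sum-cong-≗ λ j →
         trans (Δ-*ˡ (suc k) (coeff L j) (λ x → χ (lookup x j) * P x)) (cong (coeff L j *_) (Δ-χ* k j P))) ⟩
  ∑[ j < suc k ] (coeff L j * Δ k (λ y → P (insertAt y j true))) + const L * Δ (suc k) P ∎
  where open ≡-Reasoning

∏⟦_⟧ : ∀ {m k} → (Fin m → AffineForm k) → Vec Bool k → ℤ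
∏⟦ Ls ⟧ x = product (λ i → ⟦ Ls i ⟧ x)

∏⟦restrict⟧ : ∀ {m k} (Ls : Fin m → AffineForm (suc k)) j (y : Vec Bool k) →
  ∏⟦ Ls ⟧ (insertAt y j true) ≡ ∏⟦ (λ i → restrict (Ls i) j) ⟧ y
∏⟦restrict⟧ {zero}  Ls j y = refl
∏⟦restrict⟧ {suc m} Ls j y = cong₂ _*_ (⟦restrict⟧ (Ls zero) j y) (∏⟦restrict⟧ (Ls ∘ suc) j y)

Δ-∏⟦⟧ : ∀ {m k} (Ls : Fin (suc m) → AffineForm (suc k)) →
  Δ (suc k) ∏⟦ Ls ⟧
    ≡ ∑[ j < suc k ] (coeff (Ls zero) j * Δ k ∏⟦ (λ i → restrict (Ls (suc i)) j) ⟧)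
        + const (Ls zero) * Δ (suc k) ∏⟦ Ls ∘ suc ⟧
Δ-∏⟦⟧ {k = k} Ls =
  trans (Δ-⟦⟧* (Ls zero) ∏⟦ Ls ∘ suc ⟧)
        (cong (_+ const (Ls zero) * Δ (suc k) ∏⟦ Ls ∘ suc ⟧)
              (sum-cong-≗ λ j → cong (coeff (Ls zero) j *_) (Δ-cong k (∏⟦restrict⟧ (Ls ∘ suc) j))))

Δ-∏⟦⟧-vanishes : ∀ {m k} (Ls : Fin m → AffineForm k) → m ℕ.< k → Δ k ∏⟦ Ls ⟧ ≡ 0ℤ
Δ-∏⟦⟧-vanishes {zero}  {suc k} Ls _ = +-inverseʳ (Δ k (λ _ → 1ℤ))
Δ-∏⟦⟧-vanishes {suc m} {suc k} Ls (s≤s m<k) = begin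
  Δ (suc k) ∏⟦ Ls ⟧
    ≡⟨ Δ-∏⟦⟧ Ls ⟩
  ∑[ j < suc k ] (a j * Δ k ∏⟦ (λ i → restrict (Ls (suc i)) j) ⟧) + c * Δ (suc k) ∏⟦ Ls ∘ suc ⟧
    ≡⟨ cong₂ _+_ (sum-cong-≗ λ j → cong (a j *_) (Δ-∏⟦⟧-vanishes (λ i → restrict (Ls (suc i)) j) m<k))
                 (cong (c *_) (Δ-∏⟦⟧-vanishes (Ls ∘ suc) (ℕ.m<n⇒m<1+n m<k))) ⟩
  ∑[ j < suc k ] (a j * 0ℤ) + c * 0ℤ
    ≡⟨ cong₂ _+_ (trans (sum-cong-≗ (*-zeroʳ ∘ a)) (sum-replicate-zero (suc k))) (*-zeroʳ c) ⟩
  0ℤ ∎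
  where
  open ≡-Reasoning
  a = coeff (Ls zero)
  c = const (Ls zero)

permanent : ∀ {k} → (Fin k → Fin k → ℤ) → ℤ
permanent {zero}  a = 1ℤ
permanent {suc k} a = ∑[ j < suc k ] (a zero j * permanent (λ r c → a (suc r) (punchIn j c)))

Δ-∏⟦⟧≡permanent : ∀ {k} (Ls : Fin k → AffineForm k) → Δ k ∏⟦ Ls ⟧ ≡ permanent (coeff ∘ Ls)
Δ-∏⟦⟧≡permanent {zero}  Ls = refl
Δ-∏⟦⟧≡permanent {suc k} Ls = begin
  Δ (suc k) ∏⟦ Ls ⟧
    ≡⟨ Δ-∏⟦⟧ Ls ⟩
  ∑[ j < suc k ] (a j * Δ k ∏⟦ (λ i → restrict (Ls (suc i)) j) ⟧) + c * Δ (suc k) ∏⟦ Ls ∘ suc ⟧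
    ≡⟨ cong₂ _+_ (sum-cong-≗ λ j → cong (a j *_) (Δ-∏⟦⟧≡permanent (λ i → restrict (Ls (suc i)) j)))
                 (cong (c *_) (Δ-∏⟦⟧-vanishes (Ls ∘ suc) (ℕ.n<1+n k))) ⟩
  permanent (coeff ∘ Ls) + c * 0ℤ
    ≡⟨ trans (cong (_+_ (permanent (coeff ∘ Ls))) (*-zeroʳ c)) (+-identityʳ _) ⟩
  permanent (coeff ∘ Ls) ∎
  where
  open ≡-Reasoning
  a = coeff (Ls zero)
  c = const (Ls zero)

∑-nonneg : ∀ {m} (t : Fin m → ℤ) → (∀ j → 0ℤ ℤ.≤ t j) → 0ℤ ℤ.≤ sum t
∑-nonneg {zero}  t t≥0 = ≤-refl
∑-nonneg {suc m} t t≥0 = +-mono-≤ (t≥0 zero) (∑-nonneg (t ∘ suc) (t≥0 ∘ suc))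

*-nonneg : ∀ {i j} → 0ℤ ℤ.≤ i → 0ℤ ℤ.≤ j → 0ℤ ℤ.≤ i * j
*-nonneg {+ m} {+ n} (+≤+ _) (+≤+ _) = subst (0ℤ ℤ.≤_) (pos-* m n) (+≤+ z≤n)

*-pos : ∀ {i j} → 0ℤ ℤ.< i → 0ℤ ℤ.< j → 0ℤ ℤ.< i * j
*-pos (+<+ (s≤s _)) (+<+ (s≤s _)) = +<+ (s≤s z≤n)

permanent-nonneg : ∀ {k} (a : Fin k → Fin k → ℤ) → (∀ i j → 0ℤ ℤ.≤ a i j) → 0ℤ ℤ.≤ permanent a
permanent-nonneg {zero}  a a≥0 = +≤+ z≤n
permanent-nonneg {suc k} a a≥0 = ∑-nonneg _ λ j →
  *-nonneg (a≥0 zero j) (permanent-nonneg _ λ r c → a≥0 (suc r) (punchIn j c))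

permanent-pos : ∀ {k} (a : Fin k → Fin k → ℤ) →
  (∀ i j → 0ℤ ℤ.≤ a i j) → (∀ i → 0ℤ ℤ.< a i i) → 0ℤ ℤ.< permanent a
permanent-pos {zero}  a a≥0 aᵢᵢ>0 = +<+ (s≤s z≤n)
permanent-pos {suc k} a a≥0 aᵢᵢ>0 =
  +-mono-<-≤ (*-pos (aᵢᵢ>0 zero) (permanent-pos _ (λ r c → a≥0 (suc r) (suc c)) (aᵢᵢ>0 ∘ suc)))
             (∑-nonneg _ λ j → *-nonneg (a≥0 zero (suc j)) (permanent-nonneg _ λ r c → a≥0 (suc r) (punchIn (suc j) c)))

product-zero : ∀ {m} (t : Fin m → ℤ) i → t i ≡ 0ℤ → product t ≡ 0ℤ
product-zero t zero    tᵢ≡0 = trans (cong (_* product (t ∘ suc)) tᵢ≡0) (*-zeroˡ (product (t ∘ suc)))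
product-zero t (suc i) tᵢ≡0 = trans (cong (t zero *_) (product-zero (t ∘ suc) i tᵢ≡0)) (*-zeroʳ (t zero))

∃-common-nonroot : ∀ {k} (Ls : Fin k → AffineForm k) →
  (∀ i j → 0ℤ ℤ.≤ coeff (Ls i) j) → (∀ i → 0ℤ ℤ.< coeff (Ls i) i) →
  ∃[ x ] ∀ i → ⟦ Ls i ⟧ x ≢ 0ℤ
∃-common-nonroot {k} Ls a≥0 aᵢᵢ>0 =
  let (x , ∏≢0) = Δ≢0⇒∃≢0 k ∏⟦ Ls ⟧ Δ≢0 in x , λ i Lᵢ≡0 → ∏≢0 (product-zero _ i Lᵢ≡0)
  where
  Δ≢0 : Δ k ∏⟦ Ls ⟧ ≢ 0ℤ
  Δ≢0 Δ≡0 = <-irrefl (trans (sym Δ≡0) (Δ-∏⟦⟧≡permanent Ls)) (permanent-pos (coeff ∘ Ls) a≥0 aᵢᵢ>0)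

∣p∣≢0⇒nonempty : ∀ {n} (p : Subset n) → ∣ p ∣ ≢ 0 → Nonempty p
∣p∣≢0⇒nonempty {n} p ∣p∣≢0 with nonempty? p
... | yes p≢∅ = p≢∅
... | no  p≡∅ = contradiction (trans (cong ∣_∣ (Empty-unique p≡∅)) (∣⊥∣≡0 n)) ∣p∣≢0

1<∣p∣⇒∃≢ : ∀ {n} (p : Subset n) → 1 ℕ.< ∣ p ∣ → ∀ x → ∃[ y ] y ∈ p × y ≢ x
1<∣p∣⇒∃≢ p 1<∣p∣ x with any? (λ y → y ∈? p ×-dec ¬? (y ≟ x))
... | yes found = found
... | no  none  = contradiction (subst (∣ p ∣ ℕ.≤_) (∣⁅x⁆∣≡1 x) (p⊆q⇒∣p∣≤∣q∣ p⊆⁅x⁆)) (ℕ.<⇒≱ 1<∣p∣)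
  where
  p⊆⁅x⁆ : p ⊆ ⁅ x ⁆
  p⊆⁅x⁆ {y} y∈p = subst (_∈ ⁅ x ⁆) (sym y≡x) (x∈⁅x⁆ x)
    where y≡x = decidable-stable (y ≟ x) (λ y≢x → none (y , y∈p , y≢x))

∣p∣<n⇒∃∉ : ∀ {n} (p : Subset n) → ∣ p ∣ ℕ.< n → ∃[ x ] x ∉ p
∣p∣<n⇒∃∉ {n} p ∣p∣<n = ¬∀⟶∃¬ n (_∈ p) (_∈? p) λ all∈p →
  ℕ.<⇒≱ ∣p∣<n (subst (ℕ._≤ ∣ p ∣) (∣⊤∣≡n n) (p⊆q⇒∣p∣≤∣q∣ {p = ⊤} (λ {x} _ → all∈p x)))

injective⇒surjective : ∀ {n} (f : Fin n → Fin n) → Injective _≡_ _≡_ f → ∀ y → ∃[ x ] f x ≡ y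
injective⇒surjective {ℕ.suc n} f f-inj y with any? (λ x → f x ≟ y)
... | yes found  = found
... | no  missed = contradiction (injective⇒≤ g-inj) (ℕ.n≮n n)
  where
  g : Fin (ℕ.suc n) → Fin n
  g x = punchOut {i = y} (λ y≡fx → missed (x , sym y≡fx))
  g-inj : Injective _≡_ _≡_ g
  g-inj gx≡gx′ = f-inj (punchOut-injective {i = y} _ _ gx≡gx′)

data Minimum {n} (B : Pred (Fin n) 0ℓ) : Set where
  none  : (∀ i → ¬ B i) → Minimum B
  least : ∀ i → B i → (∀ j → B j → i ≤ j) → Minimum B

minimum : ∀ {n} {B : Pred (Fin n) 0ℓ} → Decidable B → Minimum B
minimum {ℕ.zero}  B? = none λ ()
minimum {ℕ.suc n} B? with B? zero | minimum (B? ∘ suc)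
... | yes b₀ | _             = least zero b₀ λ _ _ → z≤n
... | no ¬b₀ | none ¬b       = none λ { zero → ¬b₀ ; (suc i) → ¬b i }
... | no ¬b₀ | least i bᵢ min =
  least (suc i) bᵢ λ { zero b₀ → contradiction b₀ ¬b₀ ; (suc j) bⱼ → s≤s (min j bⱼ) }

module CyclicSuccessor {n} {A : Pred (Fin n) 0ℓ} (A? : Decidable A) where

  Above : Fin n → Pred (Fin n) 0ℓ
  Above d e = A e × d < e

  successor : (d : Fin n) → Minimum (Above d) → Minimum A → Fin n
  successor d (least e _ _) _             = e
  successor d (none _)      (least e _ _) = e
  successor d (none _)      (none _)      = d

  leastAbove : ∀ d → Minimum (Above d)
  leastAbove d = minimum (λ e → A? e ×-dec d <? e)

  next : Fin n → Fin n
  next d = successor d (leastAbove d) (minimum A?)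

  successor-∈ : ∀ {d} → A d → ∀ above first → A (successor d above first)
  successor-∈ A-d (least e (A-e , _) _) first         = A-e
  successor-∈ A-d (none _)              (least e A-e _) = A-e
  successor-∈ A-d (none _)              (none ¬A)       = contradiction A-d (¬A _)

  successor-≢ : ∀ {d e} → A d → A e → e ≢ d → ∀ above first → successor d above first ≢ d
  successor-≢ A-d A-e e≢d (least e′ (_ , d<e′) _) first eq = <⇒≢ d<e′ (sym eq)
  successor-≢ A-d A-e e≢d (none ¬above) (least e′ _ min) refl =
    ¬above _ (A-e , ℕ.≤∧≢⇒< (min _ A-e) (e≢d ∘ sym ∘ toℕ-injective))
  successor-≢ A-d A-e e≢d (none _)      (none ¬A) _ = ¬A _ A-d

  <⇒successor≢ : ∀ {d₁ d₂} → d₁ < d₂ → A d₁ → A d₂ → ∀ above₁ above₂ first →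
    successor d₁ above₁ first ≢ successor d₂ above₂ first
  <⇒successor≢ d₁<d₂ A-d₁ A-d₂ (none ¬above) _ _ = contradiction (A-d₂ , d₁<d₂) (¬above _)
  <⇒successor≢ d₁<d₂ A-d₁ A-d₂ (least e₁ _ min₁) (least e₂ (_ , d₂<e₂) _) first =
    <⇒≢ (ℕ.≤-<-trans (min₁ _ (A-d₂ , d₁<d₂)) d₂<e₂)
  <⇒successor≢ d₁<d₂ A-d₁ A-d₂ (least e₁ (_ , d₁<e₁) _) (none _) (least e (A-e) minA) =
    <⇒≢ (ℕ.≤-<-trans (minA _ A-d₁) d₁<e₁) ∘ sym
  <⇒successor≢ d₁<d₂ A-d₁ A-d₂ (least _ _ _) (none _) (none ¬A) _ = ¬A _ A-d₁

  next-∈ : ∀ {d} → A d → A (next d)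
  next-∈ A-d = successor-∈ A-d (leastAbove _) (minimum A?)

  next-≢ : ∀ {d e} → A d → A e → e ≢ d → next d ≢ d
  next-≢ A-d A-e e≢d = successor-≢ A-d A-e e≢d (leastAbove _) (minimum A?)

  <⇒next≢ : ∀ {d d′} → d < d′ → A d → A d′ → next d ≢ next d′
  <⇒next≢ {d} {d′} d<d′ A-d A-d′ = <⇒successor≢ d<d′ A-d A-d′ (leastAbove d) (leastAbove d′) (minimum A?)

  next-injective : ∀ {d₁ d₂} → A d₁ → A d₂ → next d₁ ≡ next d₂ → d₁ ≡ d₂
  next-injective {d₁} {d₂} A-d₁ A-d₂ eq with <-cmp d₁ d₂
  ... | tri< d₁<d₂ _ _ = contradiction eq (<⇒next≢ d₁<d₂ A-d₁ A-d₂)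
  ... | tri≈ _ d₁≡d₂ _ = d₁≡d₂
  ... | tri> _ _ d₂<d₁ = contradiction (sym eq) (<⇒next≢ d₂<d₁ A-d₂ A-d₁)

-- Projective planes

module PlaneGeometry {q} (Π : ProjectivePlane q) where

  open ProjectivePlane Π

  Point Line : Set
  Point = Fin (planeSize q)
  Line  = Fin (planeSize q)

  join : (X Y : Point) → X ≢ Y → Line
  join X Y X≢Y = proj₁ (two-points X Y X≢Y)

  ∈-joinˡ : ∀ {X Y} (X≢Y : X ≢ Y) → X ∈ line (join X Y X≢Y)
  ∈-joinˡ {X} {Y} X≢Y = proj₁ (proj₁ (proj₂ (two-points X Y X≢Y)))

  ∈-joinʳ : ∀ {X Y} (X≢Y : X ≢ Y) → Y ∈ line (join X Y X≢Y)
  ∈-joinʳ {X} {Y} X≢Y = proj₂ (proj₁ (proj₂ (two-points X Y X≢Y)))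

  lines-equal : ∀ {X Y l l′} → X ≢ Y →
    X ∈ line l → Y ∈ line l → X ∈ line l′ → Y ∈ line l′ → l ≡ l′
  lines-equal {X} {Y} X≢Y X∈l Y∈l X∈l′ Y∈l′ =
    trans (sym (unique (X∈l , Y∈l))) (unique (X∈l′ , Y∈l′))
    where unique = proj₂ (proj₂ (two-points X Y X≢Y))

  meet : (l l′ : Line) → l ≢ l′ → Point
  meet l l′ l≢l′ = proj₁ (two-lines l l′ l≢l′)

  ∈-meetˡ : ∀ {l l′} (l≢l′ : l ≢ l′) → meet l l′ l≢l′ ∈ line l
  ∈-meetˡ {l} {l′} l≢l′ = proj₁ (proj₁ (proj₂ (two-lines l l′ l≢l′)))

  ∈-meetʳ : ∀ {l l′} (l≢l′ : l ≢ l′) → meet l l′ l≢l′ ∈ line l′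
  ∈-meetʳ {l} {l′} l≢l′ = proj₂ (proj₁ (proj₂ (two-lines l l′ l≢l′)))

  points-equal : ∀ {X Y l l′} → l ≢ l′ →
    X ∈ line l → X ∈ line l′ → Y ∈ line l → Y ∈ line l′ → X ≡ Y
  points-equal {l = l} {l′} l≢l′ X∈l X∈l′ Y∈l Y∈l′ =
    trans (sym (unique (X∈l , X∈l′))) (unique (Y∈l , Y∈l′))
    where unique = proj₂ (proj₂ (two-lines l l′ l≢l′))

  ∈-resp-line : ∀ {X l l′} → l ≡ l′ → X ∈ line l → X ∈ line l′
  ∈-resp-line l≡l′ = subst (λ l → _ ∈ line l) l≡l′

  ∉⇒≢ : ∀ {X Y l} → X ∈ line l → Y ∉ line l → X ≢ Y
  ∉⇒≢ X∈l Y∉l refl = Y∉l X∈l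

  module Matching
    (m : Line) (P : Point) (P∉m : P ∉ line m) (Q : Point) (Q∈m : Q ∈ line m)
    (σ : Point → Point)
    (σ-∈ : ∀ {D} → D ∈ line m → σ D ∈ line m)
    (σ-≢ : ∀ {D} → D ∈ line m → σ D ≢ D)
    (σ-injective : ∀ {D E} → D ∈ line m → E ∈ line m → σ D ≡ σ E → D ≡ E)
    where

    P≢ : ∀ {X} → X ∈ line m → P ≢ X
    P≢ X∈m = ∉⇒≢ X∈m P∉m ∘ sym

    joinP≢m : ∀ {X} (P≢X : P ≢ X) → join P X P≢X ≢ m
    joinP≢m P≢X eq = P∉m (∈-resp-line eq (∈-joinˡ P≢X))

    joinP-injective : ∀ {X Y} (X∈m : X ∈ line m) (Y∈m : Y ∈ line m) →
      join P X (P≢ X∈m) ≡ join P Y (P≢ Y∈m) → X ≡ Y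
    joinP-injective X∈m Y∈m eq =
      points-equal (joinP≢m (P≢ Y∈m)) (∈-resp-line eq (∈-joinʳ (P≢ X∈m))) X∈m (∈-joinʳ (P≢ Y∈m)) Y∈m

    foot : (X : Point) → P ≢ X → Point
    foot X P≢X = meet (join P X P≢X) m (joinP≢m P≢X)

    foot∈m : ∀ {X} (P≢X : P ≢ X) → foot X P≢X ∈ line m
    foot∈m P≢X = ∈-meetʳ (joinP≢m P≢X)

    offLine : (X : Point) → X ∉ line m → P ≢ X → Line
    offLine X X∉m P≢X = join X (σ (foot X P≢X)) (∉⇒≢ (σ-∈ (foot∈m P≢X)) X∉m ∘ sym)

    ∈-offLine : ∀ {X} X∉m P≢X → X ∈ line (offLine X X∉m P≢X)
    ∈-offLine X∉m P≢X = ∈-joinˡ _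

    σfoot∈offLine : ∀ {X} X∉m P≢X → σ (foot X P≢X) ∈ line (offLine X X∉m P≢X)
    σfoot∈offLine X∉m P≢X = ∈-joinʳ _

    offLine≢m : ∀ {X} X∉m P≢X → offLine X X∉m P≢X ≢ m
    offLine≢m X∉m P≢X eq = X∉m (∈-resp-line eq (∈-offLine X∉m P≢X))

    P∉offLine : ∀ {X} X∉m P≢X → P ∉ line (offLine X X∉m P≢X)
    P∉offLine {X} X∉m P≢X P∈ℓ = σ-≢ (foot∈m P≢X) σfoot≡foot
      where
      ℓ≡PX : offLine X X∉m P≢X ≡ join P X P≢X
      ℓ≡PX = lines-equal P≢X P∈ℓ (∈-offLine X∉m P≢X) (∈-joinˡ P≢X) (∈-joinʳ P≢X)
      σfoot≡foot : σ (foot X P≢X) ≡ foot X P≢X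
      σfoot≡foot = points-equal (joinP≢m P≢X)
        (∈-resp-line ℓ≡PX (σfoot∈offLine X∉m P≢X)) (σ-∈ (foot∈m P≢X))
        (∈-meetˡ (joinP≢m P≢X)) (foot∈m P≢X)

    joinP≢offLine : ∀ {X Y} (P≢X : P ≢ X) Y∉m P≢Y → join P X P≢X ≢ offLine Y Y∉m P≢Y
    joinP≢offLine P≢X Y∉m P≢Y eq = P∉offLine Y∉m P≢Y (∈-resp-line eq (∈-joinˡ P≢X))

    -- The line through X and σ(foot X) meets m at σ(foot X); σ is injective,
    -- so the foot, hence the line PX, is recovered, and X is where PX meets it.
    offLine-injective : ∀ {X Y} X∉m P≢X Y∉m P≢Y → offLine X X∉m P≢X ≡ offLine Y Y∉m P≢Y → X ≡ Y
    offLine-injective {X} {Y} X∉m P≢X Y∉m P≢Y eq =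
      points-equal (joinP≢offLine P≢X X∉m P≢X) (∈-joinʳ P≢X) (∈-offLine X∉m P≢X)
        (∈-resp-line (sym PX≡PY) (∈-joinʳ P≢Y)) (∈-resp-line (sym eq) (∈-offLine Y∉m P≢Y))
      where
      σfoot≡ : σ (foot X P≢X) ≡ σ (foot Y P≢Y)
      σfoot≡ = points-equal (offLine≢m X∉m P≢X)
        (σfoot∈offLine X∉m P≢X) (σ-∈ (foot∈m P≢X))
        (∈-resp-line (sym eq) (σfoot∈offLine Y∉m P≢Y)) (σ-∈ (foot∈m P≢Y))
      foot≡ : foot X P≢X ≡ foot Y P≢Y
      foot≡ = σ-injective (foot∈m P≢X) (foot∈m P≢Y) σfoot≡
      PX≡PY : join P X P≢X ≡ join P Y P≢Y
      PX≡PY = lines-equal (P≢ (foot∈m P≢X)) (∈-joinˡ P≢X) (∈-meetˡ (joinP≢m P≢X))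
        (∈-joinˡ P≢Y) (subst (_∈ line (join P Y P≢Y)) (sym foot≡) (∈-meetˡ (joinP≢m P≢Y)))

    data Position (X : Point) : Set where
      centre  : X ≡ P → Position X
      basePoint    : X ≡ Q → Position X
      onAxis  : X ∈ line m → X ≢ Q → Position X
      offAxis : X ∉ line m → P ≢ X → Position X

    position : ∀ X → Position X
    position X with X ≟ P | X ∈? line m | X ≟ Q
    ... | yes X≡P | _       | _       = centre X≡P
    ... | no  _   | yes _   | yes X≡Q = basePoint X≡Q
    ... | no  _   | yes X∈m | no  X≢Q = onAxis X∈m X≢Q
    ... | no  X≢P | no  X∉m | _       = offAxis X∉m (X≢P ∘ sym)

    matchedLine : ∀ {X} → Position X → Line
    matchedLine     (centre _)        = join P Q (P≢ Q∈m)
    matchedLine     (basePoint _)          = m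
    matchedLine {X} (onAxis X∈m _)    = join P X (P≢ X∈m)
    matchedLine {X} (offAxis X∉m P≢X) = offLine X X∉m P≢X

    ∈-matchedLine : ∀ {X} (c : Position X) → X ∈ line (matchedLine c)
    ∈-matchedLine (centre refl)     = ∈-joinˡ _
    ∈-matchedLine (basePoint refl)       = Q∈m
    ∈-matchedLine (onAxis X∈m _)    = ∈-joinʳ _
    ∈-matchedLine (offAxis X∉m P≢X) = ∈-offLine X∉m P≢X

    matchedLine-injective : ∀ {X Y} (c : Position X) (d : Position Y) → matchedLine c ≡ matchedLine d → X ≡ Y
    matchedLine-injective (centre X≡P)       (centre Y≡P)       _  = trans X≡P (sym Y≡P)
    matchedLine-injective (centre _)         (basePoint _)      eq = contradiction eq (joinP≢m _)
    matchedLine-injective (centre _)         (onAxis Y∈m Y≢Q)   eq = contradiction (joinP-injective Q∈m Y∈m eq) (Y≢Q ∘ sym)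
    matchedLine-injective (centre _)         (offAxis Y∉m P≢Y)  eq = contradiction eq (joinP≢offLine _ Y∉m P≢Y)
    matchedLine-injective (basePoint _)      (centre _)         eq = contradiction (sym eq) (joinP≢m _)
    matchedLine-injective (basePoint X≡Q)    (basePoint Y≡Q)    _  = trans X≡Q (sym Y≡Q)
    matchedLine-injective (basePoint _)      (onAxis _ _)       eq = contradiction (sym eq) (joinP≢m _)
    matchedLine-injective (basePoint _)      (offAxis Y∉m P≢Y)  eq = contradiction (sym eq) (offLine≢m Y∉m P≢Y)
    matchedLine-injective (onAxis X∈m X≢Q)   (centre _)         eq = contradiction (joinP-injective X∈m Q∈m eq) X≢Q
    matchedLine-injective (onAxis _ _)       (basePoint _)      eq = contradiction eq (joinP≢m _)
    matchedLine-injective (onAxis X∈m _)     (onAxis Y∈m _)     eq = joinP-injective X∈m Y∈m eq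
    matchedLine-injective (onAxis _ _)       (offAxis Y∉m P≢Y)  eq = contradiction eq (joinP≢offLine _ Y∉m P≢Y)
    matchedLine-injective (offAxis X∉m P≢X)  (centre _)         eq = contradiction (sym eq) (joinP≢offLine _ X∉m P≢X)
    matchedLine-injective (offAxis X∉m P≢X)  (basePoint _)      eq = contradiction eq (offLine≢m X∉m P≢X)
    matchedLine-injective (offAxis X∉m P≢X)  (onAxis _ _)       eq = contradiction (sym eq) (joinP≢offLine _ X∉m P≢X)
    matchedLine-injective (offAxis X∉m P≢X)  (offAxis Y∉m P≢Y)  eq = offLine-injective X∉m P≢X Y∉m P≢Y eq

lineSize<planeSize : ∀ q → suc (suc q) ℕ.< planeSize (suc q)
lineSize<planeSize q = ℕ.≤-trans (ℕ.≤-reflexive (cong (2 ℕ.+_) (ℕ.+-comm 1 q)))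
                                 (ℕ.+-monoˡ-≤ 1 (ℕ.+-monoˡ-≤ (suc q) (s≤s z≤n)))

record IncidenceMatching {q} (Π : ProjectivePlane q) : Set where
  field
    μ           : Fin (planeSize q) → Fin (planeSize q)
    ∈-μ         : ∀ X → X ∈ ProjectivePlane.line Π (μ X)
    μ-injective : Injective _≡_ _≡_ μ

incidenceMatching : ∀ {q} (Π : ProjectivePlane q) → IncidenceMatching Π
-- A plane of order 0 has a single point, on its single line.
incidenceMatching {zero} Π = record { μ = id ; ∈-μ = X∈lineX ; μ-injective = id }
  where
  open ProjectivePlane Π
  X∈lineX : ∀ X → X ∈ line X
  X∈lineX zero with ∣p∣≢0⇒nonempty (line zero) (λ ∣l∣≡0 → ℕ.1+n≢0 (trans (sym (line-size zero)) ∣l∣≡0))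
  ... | zero , 0∈l = 0∈l
incidenceMatching {suc q} Π = record
  { μ           = λ X → matchedLine (position X)
  ; ∈-μ         = λ X → ∈-matchedLine (position X)
  ; μ-injective = matchedLine-injective (position _) (position _)
  }
  where
  open ProjectivePlane Π
  open PlaneGeometry Π
  m : Line
  m = zero
  P-off-m : ∃[ P ] P ∉ line m
  P-off-m = ∣p∣<n⇒∃∉ (line m) (subst (ℕ._< planeSize (suc q)) (sym (line-size m)) (lineSize<planeSize q))
  Q-on-m : Nonempty (line m)
  Q-on-m = ∣p∣≢0⇒nonempty (line m) (λ ∣m∣≡0 → ℕ.1+n≢0 (trans (sym (line-size m)) ∣m∣≡0))
  open CyclicSuccessor (_∈? line m)
  next-moves : ∀ {D} → D ∈ line m → next D ≢ D
  next-moves {D} D∈m =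
    let (E , E∈m , E≢D) = 1<∣p∣⇒∃≢ (line m) (subst (1 ℕ.<_) (sym (line-size m)) (s≤s (s≤s z≤n))) D
    in next-≢ D∈m E∈m E≢D
  open Matching m (proj₁ P-off-m) (proj₂ P-off-m) (proj₁ Q-on-m) (proj₂ Q-on-m)
    next next-∈ next-moves next-injective

countingForm : ∀ {n} → Subset n → ℤ → AffineForm n
countingForm s c = affine (χ ∘ lookup s) c

⟦countingForm⟧ : ∀ {n} (s : Subset n) c x → ⟦ countingForm s c ⟧ x ≡ + ∣ x ∩ s ∣ + c
⟦countingForm⟧ s c x = cong (_+ c) (∑χχ≡∣∩∣ s x)
  where
  ∑χχ≡∣∩∣ : ∀ {n} (s x : Subset n) → ∑[ j < n ] (χ (lookup s j) * χ (lookup x j)) ≡ + ∣ x ∩ s ∣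
  ∑χχ≡∣∩∣ []      []      = refl
  ∑χχ≡∣∩∣ (b ∷ s) (c ∷ x) = trans (cong (_+_ (χ b * χ c)) (∑χχ≡∣∩∣ s x)) (head-step b c)
    where
    head-step : ∀ b c → χ b * χ c + + ∣ x ∩ s ∣ ≡ + ∣ (c ∷ x) ∩ (b ∷ s) ∣
    head-step true  true  = refl
    head-step true  false = +-identityˡ _
    head-step false true  = +-identityˡ _
    head-step false false = +-identityˡ _

χ-nonneg : ∀ b → 0ℤ ℤ.≤ χ b
χ-nonneg true  = +≤+ z≤n
χ-nonneg false = +≤+ z≤n

∈⇒χ-pos : ∀ {n} {s : Subset n} {j} → j ∈ s → 0ℤ ℤ.< χ (lookup s j)
∈⇒χ-pos j∈s rewrite []=⇒lookup j∈s = +<+ (s≤s z≤n)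

mainTheorem2 : (q : ℕ) (Π : ProjectivePlane q) (f : Fin (planeSize q) → ℕ) →
    Σ (Subset (planeSize q)) (λ S →
      ∀ l → ∣ S ∩ ProjectivePlane.line Π l ∣ ≢ f l)
mainTheorem2 q Π f = S , ∣S∩l∣≢fl
  where
  open ProjectivePlane Π
  open IncidenceMatching (incidenceMatching Π)
  form : Fin (planeSize q) → AffineForm (planeSize q)
  form X = countingForm (line (μ X)) (- + f (μ X))
  nonroot : ∃[ S ] ∀ X → ⟦ form X ⟧ S ≢ 0ℤ
  nonroot = ∃-common-nonroot form (λ X → χ-nonneg ∘ lookup (line (μ X))) (∈⇒χ-pos ∘ ∈-μ)
  S = proj₁ nonroot
  ∣S∩l∣≢fl : ∀ l → ∣ S ∩ line l ∣ ≢ f l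
  ∣S∩l∣≢fl l ∣S∩l∣≡fl with X , refl ← injective⇒surjective μ μ-injective l =
    proj₂ nonroot X (begin
      ⟦ form X ⟧ S                      ≡⟨ ⟦countingForm⟧ (line (μ X)) _ S ⟩
      + ∣ S ∩ line (μ X) ∣ - + f (μ X)  ≡⟨ cong (λ k → + k - + f (μ X)) ∣S∩l∣≡fl ⟩
      + f (μ X) - + f (μ X)             ≡⟨ +-inverseʳ (+ f (μ X)) ⟩
      0ℤ                                ∎)
    where open ≡-Reasoning
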